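{- Let $H$ be a balanced graph with $v(H)\geqslant 4$, let $(e_1,e_2,\ldots)$ be a sequence of edges of $H$ in which $e_j$ and $e_{j+1}$ share no endpoint for every $j$, and let $d \in \mathbb{N}$. Let $H_d$ be the graph constructed from this sequence as described in the context, with root $e_1$. If $F \subsetneq H_d$ is a proper subgraph of $H_d$ whose vertex set contains both endpoints of the root of $H_d$, then $$e(F) \,\leqslant\, \big(v(F) - 2\big)\lambda(H).$$
   Context: A graph $H$ is balanced if $e(H) \geqslant 2v(H)-2$ and $\frac{e(F)-1}{v(F)-2} \leqslant \lambda(H) := \frac{e(H)-2}{v(H)-2}$ for every proper subgraph $F \subsetneq H$ with $v(F)\geqslant 3$. Construction of $H_d$: take $d$ copies $H^{(1)},\ldots,H^{(d)}$ of $H$; for each $1 \leqslant j \leqslant d-1$, identify the two endpoints of the edge $e_{j+1}$ in $H^{(j)}$ with the two endpoints of the edge $e_{j+1}$ in $H^{(j+1)}$ (so consecutive copies share exactly these two vertices and no other copies share vertices). Then remove the edge $e_1$ from $H^{(1)}$ and, for each $1 \leqslant j \leqslant d-1$, remove the (shared) edge $e_{j+1}$ of $H^{(j)} \cap H^{(j+1)}$. The resulting graph is $H_d$; its root is the pair $e_1$ (the removed edge of $H^{(1)}$), which is not an edge of $H_d$. -}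

module Defs where

open import Data.Bool using (Bool; true; false; _∧_; _∨_; not; if_then_else_)
open import Data.Nat using (ℕ; zero; suc; _+_; _*_; _≤_; _<_; _<ᵇ_; _≡ᵇ_; _≤ᵇ_)
open import Data.Fin using (Fin; zero; suc; toℕ; combine; inject₁; _≟_; fromℕ<)
open import Data.List using (List; []; _∷_; map; concatMap)
open import Data.Bool.ListAction using (any)
open import Data.List using () renaming (allFin to allFinL)
open import Data.Product using (Σ; _×_; _,_; proj₁; proj₂; ∃)
open import Data.Sum using (_⊎_)
open import Data.Integer as ℤ using (ℤ; +_)
open import Relation.Nullary.Decidable using (⌊_⌋)
open import Relation.Binary.PropositionalEquality using (_≡_)

-- Finite simple graphs, represented inside an ambient vertex type Fin N:
-- a vertex set V ⊆ Fin N and an edge relation E (Bool-valued, decidable).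

record Gr (N : ℕ) : Set where
  constructor mkGr
  field
    V : Fin N → Bool
    E : Fin N → Fin N → Bool
open Gr public

record WF {N : ℕ} (G : Gr N) : Set where
  field
    sym     : ∀ x y → E G x y ≡ true → E G y x ≡ true
    irrefl  : ∀ x → E G x x ≡ false
    closedˡ : ∀ x y → E G x y ≡ true → V G x ≡ true

#T : List Bool → ℕ
#T []           = 0
#T (true ∷ bs)  = suc (#T bs)
#T (false ∷ bs) = #T bs

v : ∀ {N} → Gr N → ℕ
v {N} G = #T (map (V G) (allFinL N))

e : ∀ {N} → Gr N → ℕ
e {N} G = #T (concatMap (λ i → map (λ j → E G i j ∧ (toℕ i <ᵇ toℕ j)) (allFinL N)) (allFinL N))

record Subgraph {N : ℕ} (F G : Gr N) : Set where
  field
    V⊆ : ∀ x → V F x ≡ true → V G x ≡ true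
    E⊆ : ∀ x y → E F x y ≡ true → E G x y ≡ true

ProperSubgraph : ∀ {N} → Gr N → Gr N → Set
ProperSubgraph F G =
  Subgraph F G ×
  ((∃ λ x → V G x ≡ true × V F x ≡ false) ⊎
   (∃ λ x → ∃ λ y → E G x y ≡ true × E F x y ≡ false))

-- Balanced: e(H) ≥ 2v(H) - 2, and for every proper subgraph F with
-- v(F) ≥ 3:  (e(F)-1)/(v(F)-2) ≤ λ(H) = (e(H)-2)/(v(H)-2),
-- written with cleared (positive) denominators over ℤ.
Balanced : ∀ {N} → Gr N → Set
Balanced {N} H =
  (2 * v H ≤ e H + 2) ×
  (∀ (F : Gr N) → WF F → ProperSubgraph F H → 3 ≤ v F →
     ((+ e F) ℤ.- + 1) ℤ.* ((+ v H) ℤ.- + 2) ℤ.≤ ((+ e H) ℤ.- + 2) ℤ.* ((+ v F) ℤ.- + 2))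

-- Edge sequences and the construction H_d.
-- An edge is an ordered pair of vertices; the sequence (e_1, e_2, ...)
-- is  es : ℕ → Fin n × Fin n  with es 0 = e_1, es 1 = e_2, ...

eqF : ∀ {n} → Fin n → Fin n → Bool
eqF x y = ⌊ x ≟ y ⌋

endpt : ∀ {n} → Fin n → Fin n × Fin n → Bool
endpt x (u , w) = eqF x u ∨ eqF x w

samePair : ∀ {n} → Fin n → Fin n → Fin n × Fin n → Bool
samePair x y (u , w) = (eqF x u ∧ eqF y w) ∨ (eqF x w ∧ eqF y u)

module Construction {n : ℕ} (H : Gr n) (es : ℕ → Fin n × Fin n) (d : ℕ) where

  -- Copies are indexed k = 0, …, d-1 (copy k is H^(k+1) of the paper).
  -- Copy k and copy k+1 are glued along es (k+1) (= e_{k+2} of the paper),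
  -- identifying equally-labelled endpoints.  The ambient vertex type is
  -- Fin (d * n) ≅ Fin d × Fin n; vertex x of copy k is represented by
  -- combine k x, except when k ≥ 1 and x is an endpoint of es k, in which
  -- case it is identified with vertex x of copy k-1.
  canon : Fin d → Fin n → Fin (d * n)
  canon k@zero  x = combine k x
  canon (suc k) x =
    if endpt x (es (suc (toℕ k))) then combine (inject₁ k) x else combine (suc k) x

  removed : Fin d → Fin n → Fin n → Bool
  removed k x y =
    ((toℕ k ≡ᵇ 0) ∧ samePair x y (es 0)) ∨
    (not (toℕ k ≡ᵇ 0) ∧ samePair x y (es (toℕ k))) ∨
    ((suc (suc (toℕ k)) ≤ᵇ d) ∧ samePair x y (es (suc (toℕ k))))

  eqV : Fin (d * n) → Fin (d * n) → Bool
  eqV a b = ⌊ a ≟ b ⌋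

  Hd : Gr (d * n)
  Hd = mkGr
    (λ a → any (λ k → any (λ x → V H x ∧ eqV (canon k x) a) (allFinL n)) (allFinL d))
    (λ a b → any (λ k → any (λ x → any (λ y →
        E H x y ∧ not (removed k x y) ∧ eqV (canon k x) a ∧ eqV (canon k y) b)
        (allFinL n)) (allFinL n)) (allFinL d))

  -- the two endpoints of the root e_1 = es 0, taken in copy 0 (needs d ≥ 1)
  root₁ root₂ : 0 < d → Fin (d * n)
  root₁ d>0 = canon (fromℕ< d>0) (proj₁ (es 0))
  root₂ d>0 = canon (fromℕ< d>0) (proj₂ (es 0))

module Submission where

-- Writing v(H) = A + 2 and e(H) = B + 2 (where A ≤ B), the claim reads e(F)·A + 2B ≤ B·v(F).
-- We cut F into its traces on the copies: the trace of copy k is the subgraph of H formed by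
-- the vertices of copy k lying in F and the edges of F inside copy k, together with the
-- deleted gluing edges of the copy whose ends both lie in F.  Each copy satisfies a budget
-- inequality (copy-budget): by the density inequality e·A + 2B ≤ B·v + A of balanced graphs
-- when its trace is a proper subgraph of H, and by a direct count when the trace is all of H.
-- A full copy may be short of 2A only when it is the last copy; this is compensated by the
-- last non-full copy preceding a full one (bonus-bound).  Summing the budgets and counting
-- the vertices and edges of F through the copies (vertex-count, edge-count) gives the claim
-- (assemble).

open import Defs
open import Data.Bool using (Bool; true; false; _∧_; _∨_; not)
open import Data.Bool.Properties
  using (T-≡; ∧-distribʳ-∨; ∧-identityʳ; ∧-zeroʳ; ∧-comm; ∨-comm; not-¬) renaming (_≟_ to _≟ᵇ_)
open import Data.Bool.ListAction using (any)
open import Data.Nat using (ℕ; zero; suc; _+_; _*_; _∸_; _≤_; _<_; _<ᵇ_; _≡ᵇ_; _≤?_; z≤n; s≤s)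
open import Data.Nat.Properties
  using (+-*-semiring; ≤-refl; ≤-reflexive; ≤-trans; ≤-antisym; <-asym; ≮⇒≥; ≰⇒>; <ᵇ-reflects-<;
         +-assoc; +-comm; +-identityʳ; *-comm; *-zeroʳ; *-identityʳ;
         +-mono-≤; +-monoˡ-≤; *-monoˡ-≤; *-monoʳ-≤; +-cancelʳ-≤; *-cancelˡ-≤;
         m≤m+n; m≤n+m; n≤0⇒n≡0; m+n≡0⇒m≡0; m∸n+n≡m; m+n≤o⇒n≤o; m+n≤o⇒m≤o∸n; module ≤-Reasoning)
open import Data.Nat.Tactic.RingSolver using (solve)
open import Data.Fin using (Fin; zero; suc; toℕ; combine; _↑ˡ_; _↑ʳ_; _≟_; inject₁; fromℕ)
open import Data.Fin.Properties using (toℕ-injective; toℕ-inject₁; suc-injective; all?; ¬∀⟶∃¬)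
open import Data.Integer as ℤ using (ℤ; +_; +≤+)
import Data.Integer.Properties as ℤ
import Data.Integer.Tactic.RingSolver as ℤ-Solver
open import Data.List using (List; []; _∷_; map; concat; tabulate; _++_)
open import Data.List using () renaming (allFin to allFinL)
open import Data.List.Properties using (map-tabulate)
open import Data.List.Relation.Unary.Any using (satisfied)
open import Data.List.Relation.Unary.Any.Properties using (any⁻)
open import Data.Product using (∃; ∃-syntax; _×_; _,_; proj₁; proj₂; map₂)
open import Data.Sum using (_⊎_; inj₁; inj₂)
open import Data.Empty using (⊥; ⊥-elim)
open import Function using (_∘_)
open import Function.Bundles using (Equivalence)
open import Relation.Nullary using (¬_; Dec; yes; no; does)
open import Relation.Nullary.Reflects using (ofʸ; ofⁿ)
open import Relation.Nullary.Decidable using (⌊_⌋; map′; _×-dec_; _→-dec_)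
open import Relation.Binary.PropositionalEquality
open import Algebra.Properties.Semiring.Sum +-*-semiring
  using (sum; sum-syntax; sum-cong-≗; ∑-distrib-+; ∑-comm; *-distribˡ-sum; sum-replicate-zero)

⟦_⟧ : Bool → ℕ
⟦ true ⟧  = 1
⟦ false ⟧ = 0

⟦⟧-mono : ∀ {a b} → (a ≡ true → b ≡ true) → ⟦ a ⟧ ≤ ⟦ b ⟧
⟦⟧-mono {false} _   = z≤n
⟦⟧-mono {true}  a⇒b rewrite a⇒b refl = ≤-refl

⟦⟧-bound : ∀ {b m} → (b ≡ true → 1 ≤ m) → ⟦ b ⟧ ≤ m
⟦⟧-bound {false} _   = z≤n
⟦⟧-bound {true}  1≤m = 1≤m refl

⟦∧⟧ : ∀ a b → ⟦ a ∧ b ⟧ ≡ ⟦ a ⟧ * ⟦ b ⟧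
⟦∧⟧ true  b = sym (+-identityʳ ⟦ b ⟧)
⟦∧⟧ false b = refl

⟦∨⟧ : ∀ a b → a ∧ b ≡ false → ⟦ a ∨ b ⟧ ≡ ⟦ a ⟧ + ⟦ b ⟧
⟦∨⟧ true  false _ = refl
⟦∨⟧ false b     _ = refl

∧-intro : ∀ {a b} → a ≡ true → b ≡ true → a ∧ b ≡ true
∧-intro refl refl = refl

∧-elimˡ : ∀ a {b} → a ∧ b ≡ true → a ≡ true
∧-elimˡ true _ = refl

∧-elimʳ : ∀ a {b} → a ∧ b ≡ true → b ≡ true
∧-elimʳ true b≡true = b≡true

∨-cases : ∀ a {b} → a ∨ b ≡ true → a ≡ true ⊎ b ≡ true
∨-cases true  _        = inj₁ refl
∨-cases false b≡true   = inj₂ b≡true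

∨-introʳ : ∀ a {b} → b ≡ true → a ∨ b ≡ true
∨-introʳ true  _    = refl
∨-introʳ false refl = refl

not-true : ∀ {a} → not a ≡ true → a ≡ false
not-true {false} _ = refl

∧-exclusive : ∀ a b → (a ≡ true → b ≡ true → ⊥) → a ∧ b ≡ false
∧-exclusive true  true  excl = ⊥-elim (excl refl refl)
∧-exclusive true  false _    = refl
∧-exclusive false _     _    = refl

∧-disjoint : ∀ a b {c d} → a ∧ b ≡ false → (a ∧ c) ∧ (b ∧ d) ≡ false
∧-disjoint true  true  ()
∧-disjoint true  false _ = ∧-zeroʳ _
∧-disjoint false _     _ = refl

does-true : ∀ {P : Set} (P? : Dec P) → does P? ≡ true → P
does-true (yes p) _ = p

does-false : ∀ {P : Set} (P? : Dec P) → does P? ≡ false → ¬ P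
does-false (no ¬p) _ = ¬p

≟-refl : ∀ {m} (x : Fin m) → ⌊ x ≟ x ⌋ ≡ true
≟-refl x with x ≟ x
... | yes _   = refl
... | no x≢x  = ⊥-elim (x≢x refl)

≟-≢ : ∀ {m} {x y : Fin m} → x ≢ y → ⌊ x ≟ y ⌋ ≡ false
≟-≢ {x = x} {y} x≢y with x ≟ y
... | yes x≡y = ⊥-elim (x≢y x≡y)
... | no _    = refl

≟-sound : ∀ {m} {x y : Fin m} → ⌊ x ≟ y ⌋ ≡ true → x ≡ y
≟-sound {x = x} {y} eq with x ≟ y
... | yes x≡y = x≡y

≟-disjoint : ∀ {m} {u w : Fin m} (x : Fin m) → u ≢ w → ⌊ x ≟ u ⌋ ∧ ⌊ x ≟ w ⌋ ≡ false
≟-disjoint {u = u} {w} x u≢w with x ≟ u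
... | no _       = refl
... | yes refl   = ≟-≢ u≢w

any-witness : ∀ {A : Set} (p : A → Bool) (xs : List A) → any p xs ≡ true → ∃ λ x → p x ≡ true
any-witness p xs h with satisfied (any⁻ p xs (Equivalence.from T-≡ h))
... | x , px = x , Equivalence.to T-≡ px

∑-mono : ∀ {m} {f g : Fin m → ℕ} → (∀ i → f i ≤ g i) → sum f ≤ sum g
∑-mono {zero}  _   = z≤n
∑-mono {suc m} f≤g = +-mono-≤ (f≤g zero) (∑-mono (f≤g ∘ suc))

term≤∑ : ∀ {m} (f : Fin m → ℕ) i → f i ≤ sum f
term≤∑ f zero    = m≤m+n (f zero) _
term≤∑ f (suc i) = ≤-trans (term≤∑ (f ∘ suc) i) (m≤n+m _ (f zero))

∑-*ˡ : ∀ {m} c (f : Fin m → ℕ) → ∑[ i < m ] (c * f i) ≡ c * sum f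
∑-*ˡ c f = sym (*-distribˡ-sum c f)

∑-zero : ∀ {m} {f : Fin m → ℕ} → (∀ i → f i ≡ 0) → sum f ≡ 0
∑-zero {m} f≡0 = trans (sum-cong-≗ f≡0) (sum-replicate-zero m)

∑-single : ∀ {m} (f : Fin m → ℕ) c → (∀ i → i ≢ c → f i ≡ 0) → sum f ≡ f c
∑-single f zero    off = trans (cong (_+_ (f zero)) (∑-zero (λ i → off (suc i) λ ()))) (+-identityʳ _)
∑-single f (suc c) off =
  trans (cong (_+ sum (f ∘ suc)) (off zero λ ()))
        (∑-single (f ∘ suc) c (λ i i≢c → off (suc i) (i≢c ∘ suc-injective)))

∑-sift : ∀ {m} (δ : Fin m → Bool) c → δ c ≡ true → (∀ i → i ≢ c → δ i ≡ false) →
         (f : Fin m → ℕ) → ∑[ i < m ] (⟦ δ i ⟧ * f i) ≡ f c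
∑-sift δ c δc δi f = trans (∑-single _ c off) (trans (cong (λ b → ⟦ b ⟧ * f c) δc) (+-identityʳ (f c)))
  where
    off : ∀ i → i ≢ c → ⟦ δ i ⟧ * f i ≡ 0
    off i i≢c rewrite δi i i≢c = refl

∑-δˡ : ∀ {m} (c : Fin m) (f : Fin m → ℕ) → ∑[ i < m ] (⟦ ⌊ i ≟ c ⌋ ⟧ * f i) ≡ f c
∑-δˡ c = ∑-sift (λ i → ⌊ i ≟ c ⌋) c (≟-refl c) (λ i → ≟-≢)

∑-δʳ : ∀ {m} (c : Fin m) (f : Fin m → ℕ) → ∑[ i < m ] (⟦ ⌊ c ≟ i ⌋ ⟧ * f i) ≡ f c
∑-δʳ c = ∑-sift (λ i → ⌊ c ≟ i ⌋) c (≟-refl c) (λ i i≢c → ≟-≢ (i≢c ∘ sym))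

∑∑-outward : ∀ {p q m} (f : Fin p → Fin q → Fin m → ℕ) →
             ∑[ a < p ] ∑[ b < q ] ∑[ k < m ] f a b k ≡ ∑[ k < m ] ∑[ a < p ] ∑[ b < q ] f a b k
∑∑-outward {q = q} f = trans (sum-cong-≗ (λ a → ∑-comm (f a))) (∑-comm (λ a k → ∑[ b < q ] f a b k))

∑∑-δ : ∀ {p} (c c′ : Fin p) w → ∑[ a < p ] ∑[ b < p ] (⟦ ⌊ c ≟ a ⌋ ⟧ * (⟦ ⌊ c′ ≟ b ⌋ ⟧ * w)) ≡ w
∑∑-δ c c′ w =
  trans (sum-cong-≗ (λ a → trans (∑-*ˡ ⟦ ⌊ c ≟ a ⌋ ⟧ (λ b → ⟦ ⌊ c′ ≟ b ⌋ ⟧ * w))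
                                 (cong (⟦ ⌊ c ≟ a ⌋ ⟧ *_) (∑-δʳ c′ (λ _ → w)))))
        (∑-δʳ c (λ _ → w))

∑-↑ : ∀ {m n} (f : Fin (m + n) → ℕ) → sum f ≡ ∑[ i < m ] f (i ↑ˡ n) + ∑[ j < n ] f (m ↑ʳ j)
∑-↑ {zero}  f = refl
∑-↑ {suc m} f = trans (cong (_+_ (f zero)) (∑-↑ {m} (f ∘ suc))) (sym (+-assoc (f zero) _ _))

∑-combine : ∀ {d n} (f : Fin (d * n) → ℕ) → sum f ≡ ∑[ k < d ] ∑[ x < n ] f (combine k x)
∑-combine {zero}      f = refl
∑-combine {suc d} {n} f = trans (∑-↑ {n} f) (cong (_+_ (sum (λ x → f (x ↑ˡ (d * n))))) (∑-combine {d} (f ∘ (n ↑ʳ_))))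

∑-linear₂ : ∀ {m} a b (f g : Fin m → ℕ) → ∑[ i < m ] (a * f i + b * g i) ≡ a * sum f + b * sum g
∑-linear₂ a b f g = trans (∑-distrib-+ (λ i → a * f i) (λ i → b * g i)) (cong₂ _+_ (∑-*ˡ a f) (∑-*ˡ b g))

∑-linear : ∀ {m} a b c d (f g h k : Fin m → ℕ) →
           ∑[ i < m ] (a * f i + b * g i + c * h i + d * k i) ≡ a * sum f + b * sum g + c * sum h + d * sum k
∑-linear a b c d f g h k =
  trans (∑-distrib-+ _ (λ i → d * k i))
    (cong₂ _+_ (trans (∑-distrib-+ _ (λ i → c * h i))
                 (cong₂ _+_ (∑-linear₂ a b f g) (∑-*ˡ c h)))
               (∑-*ˡ d k))

#T-tabulate : ∀ {m} (P : Fin m → Bool) → #T (tabulate P) ≡ ∑[ i < m ] ⟦ P i ⟧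
#T-tabulate {zero}  P = refl
#T-tabulate {suc m} P with P zero
... | true  = cong suc (#T-tabulate (P ∘ suc))
... | false = #T-tabulate (P ∘ suc)

#T-++ : ∀ bs cs → #T (bs ++ cs) ≡ #T bs + #T cs
#T-++ []           cs = refl
#T-++ (true ∷ bs)  cs = cong suc (#T-++ bs cs)
#T-++ (false ∷ bs) cs = #T-++ bs cs

#T-concat : ∀ {m} (L : Fin m → List Bool) → #T (concat (tabulate L)) ≡ ∑[ i < m ] #T (L i)
#T-concat {zero}  L = refl
#T-concat {suc m} L = trans (#T-++ (L zero) _) (cong (_+_ (#T (L zero))) (#T-concat (L ∘ suc)))

#T-allFin : ∀ {m} (P : Fin m → Bool) → #T (map P (allFinL m)) ≡ ∑[ i < m ] ⟦ P i ⟧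
#T-allFin P = trans (cong #T (map-tabulate (λ i → i) P)) (#T-tabulate P)

v-∑ : ∀ {N} (G : Gr N) → v G ≡ ∑[ x < N ] ⟦ V G x ⟧
v-∑ G = #T-allFin (V G)

e-∑ : ∀ {N} (G : Gr N) → e G ≡ ∑[ x < N ] ∑[ y < N ] ⟦ E G x y ∧ (toℕ x <ᵇ toℕ y) ⟧
e-∑ {N} G =
  trans (cong (#T ∘ concat) (map-tabulate (λ i → i) row))
        (trans (#T-concat row) (sum-cong-≗ (λ x → #T-allFin (λ y → E G x y ∧ (toℕ x <ᵇ toℕ y)))))
  where
    row : Fin N → List Bool
    row x = map (λ y → E G x y ∧ (toℕ x <ᵇ toℕ y)) (allFinL N)

pairs : ∀ {N} → (Fin N → Fin N → Bool) → ℕ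
pairs {N} R = ∑[ x < N ] ∑[ y < N ] ⟦ R x y ⟧

pairs-∨ : ∀ {N} (R S : Fin N → Fin N → Bool) → (∀ x y → R x y ∧ S x y ≡ false) →
          pairs (λ x y → R x y ∨ S x y) ≡ pairs R + pairs S
pairs-∨ R S disjoint =
  trans (sum-cong-≗ (λ x → trans (sum-cong-≗ (λ y → ⟦∨⟧ (R x y) (S x y) (disjoint x y)))
                                 (∑-distrib-+ (λ y → ⟦ R x y ⟧) (λ y → ⟦ S x y ⟧))))
        (∑-distrib-+ (λ x → ∑[ y < _ ] ⟦ R x y ⟧) (λ x → ∑[ y < _ ] ⟦ S x y ⟧))

pairs-mono : ∀ {N} {R S : Fin N → Fin N → Bool} → (∀ x y → R x y ≡ true → S x y ≡ true) → pairs R ≤ pairs S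
pairs-mono R⇒S = ∑-mono (λ x → ∑-mono (λ y → ⟦⟧-mono (R⇒S x y)))

E-sym : ∀ {N} {G : Gr N} → WF G → ∀ x y → E G x y ≡ E G y x
E-sym {G = G} wf x y with E G x y in exy | E G y x in eyx
... | true  | true  = refl
... | false | false = refl
... | true  | false = trans (sym (WF.sym wf x y exy)) eyx
... | false | true  = trans (sym exy) (WF.sym wf y x eyx)

closedʳ : ∀ {N} {G : Gr N} → WF G → ∀ x y → E G x y ≡ true → V G y ≡ true
closedʳ wf x y exy = WF.closedˡ wf y x (WF.sym wf x y exy)

edge-halves : ∀ {N} {G : Gr N} → WF G → ∀ x y →
              ⟦ E G x y ⟧ ≡ ⟦ E G x y ∧ (toℕ x <ᵇ toℕ y) ⟧ + ⟦ E G y x ∧ (toℕ y <ᵇ toℕ x) ⟧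
edge-halves {G = G} wf x y rewrite E-sym wf y x with E G x y in exy
... | false = refl
... | true with toℕ x <ᵇ toℕ y | <ᵇ-reflects-< (toℕ x) (toℕ y) | toℕ y <ᵇ toℕ x | <ᵇ-reflects-< (toℕ y) (toℕ x)
...   | true  | ofʸ x<y  | true  | ofʸ y<x  = ⊥-elim (<-asym x<y y<x)
...   | true  | _        | false | _        = refl
...   | false | _        | true  | _        = refl
...   | false | ofⁿ x≮y  | false | ofⁿ y≮x  = ⊥-elim (not-¬ exy loop)
  where
    loop : E G x y ≡ false
    loop rewrite toℕ-injective (≤-antisym (≮⇒≥ y≮x) (≮⇒≥ x≮y)) = WF.irrefl wf y

handshake : ∀ {N} (G : Gr N) → WF G → 2 * e G ≡ pairs (E G)
handshake {N} G wf = sym (begin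
    pairs (E G)
  ≡⟨ sum-cong-≗ (λ x → trans (sum-cong-≗ (edge-halves wf x)) (∑-distrib-+ (below x) (λ y → below y x))) ⟩
    ∑[ x < N ] (∑[ y < N ] below x y + ∑[ y < N ] below y x)
  ≡⟨ ∑-distrib-+ (λ x → ∑[ y < N ] below x y) (λ x → ∑[ y < N ] below y x) ⟩
    ∑[ x < N ] ∑[ y < N ] below x y + ∑[ x < N ] ∑[ y < N ] below y x
  ≡⟨ cong (_+_ (∑[ x < N ] ∑[ y < N ] below x y)) (∑-comm (λ x y → below y x)) ⟩
    ∑[ x < N ] ∑[ y < N ] below x y + ∑[ y < N ] ∑[ x < N ] below y x
  ≡⟨ cong (λ t → t + t) (sym (e-∑ G)) ⟩
    e G + e G
  ≡⟨ cong (_+_ (e G)) (sym (+-identityʳ (e G))) ⟩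
    2 * e G ∎)
  where
    open ≡-Reasoning
    below : Fin N → Fin N → ℕ
    below x y = ⟦ E G x y ∧ (toℕ x <ᵇ toℕ y) ⟧

edges≤ : ∀ {N} (G : Gr N) → WF G → 2 * e G + v G ≤ v G * v G
edges≤ {N} G wf = begin
    2 * e G + v G
  ≡⟨ cong₂ _+_ (handshake G wf) (trans (v-∑ G) (sum-cong-≗ (λ x → sym (∑-δʳ x (λ y → ⟦ V G y ⟧))))) ⟩
    pairs (E G) + ∑[ x < N ] ∑[ y < N ] (⟦ ⌊ x ≟ y ⌋ ⟧ * ⟦ V G y ⟧)
  ≡⟨ sym (∑-distrib-+ _ (λ x → ∑[ y < N ] (⟦ ⌊ x ≟ y ⌋ ⟧ * ⟦ V G y ⟧))) ⟩
    ∑[ x < N ] (∑[ y < N ] ⟦ E G x y ⟧ + ∑[ y < N ] (⟦ ⌊ x ≟ y ⌋ ⟧ * ⟦ V G y ⟧))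
  ≡⟨ sum-cong-≗ (λ x → sym (∑-distrib-+ (λ y → ⟦ E G x y ⟧) (λ y → ⟦ ⌊ x ≟ y ⌋ ⟧ * ⟦ V G y ⟧))) ⟩
    ∑[ x < N ] ∑[ y < N ] (⟦ E G x y ⟧ + ⟦ ⌊ x ≟ y ⌋ ⟧ * ⟦ V G y ⟧)
  ≤⟨ ∑-mono (λ x → ∑-mono (λ y → pointwise x y)) ⟩
    ∑[ x < N ] ∑[ y < N ] (⟦ V G x ⟧ * ⟦ V G y ⟧)
  ≡⟨ sum-cong-≗ (λ x → ∑-*ˡ ⟦ V G x ⟧ (λ y → ⟦ V G y ⟧)) ⟩
    ∑[ x < N ] (⟦ V G x ⟧ * v′)
  ≡⟨ trans (sum-cong-≗ (λ x → *-comm ⟦ V G x ⟧ v′)) (∑-*ˡ v′ (λ x → ⟦ V G x ⟧)) ⟩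
    v′ * v′
  ≡⟨ cong (λ t → t * t) (sym (v-∑ G)) ⟩
    v G * v G ∎
  where
    open ≤-Reasoning
    v′ = ∑[ y < N ] ⟦ V G y ⟧
    loopless : ∀ x y → E G x y ≡ true → x ≢ y
    loopless x .x exx refl with trans (sym exx) (WF.irrefl wf x)
    ... | ()
    pointwise : ∀ x y → ⟦ E G x y ⟧ + ⟦ ⌊ x ≟ y ⌋ ⟧ * ⟦ V G y ⟧ ≤ ⟦ V G x ⟧ * ⟦ V G y ⟧
    pointwise x y with E G x y in exy
    ... | true rewrite WF.closedˡ wf x y exy | closedʳ wf x y exy | ≟-≢ (loopless x y exy) = ≤-refl
    ... | false with x ≟ y
    ...   | no _     = z≤n
    ...   | yes refl with V G x
    ...     | true  = ≤-refl
    ...     | false = z≤n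

v-mono : ∀ {N} {F G : Gr N} → Subgraph F G → v F ≤ v G
v-mono {F = F} {G} F⊆G =
  subst₂ _≤_ (sym (v-∑ F)) (sym (v-∑ G)) (∑-mono (λ x → ⟦⟧-mono (Subgraph.V⊆ F⊆G x)))

e-mono : ∀ {N} {F G : Gr N} → Subgraph F G → e F ≤ e G
e-mono {F = F} {G} F⊆G =
  subst₂ _≤_ (sym (e-∑ F)) (sym (e-∑ G)) (∑-mono (λ x → ∑-mono (λ y → ⟦⟧-mono (edge x y))))
  where
    edge : ∀ x y → E F x y ∧ (toℕ x <ᵇ toℕ y) ≡ true → E G x y ∧ (toℕ x <ᵇ toℕ y) ≡ true
    edge x y h with E F x y in exy
    ... | true rewrite Subgraph.E⊆ F⊆G x y exy = h

implies? : ∀ a b → Dec (a ≡ true → b ≡ true)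
implies? a b = (a ≟ᵇ true) →-dec (b ≟ᵇ true)

subgraph? : ∀ {N} (F G : Gr N) → Dec (Subgraph F G)
subgraph? F G =
  map′ (λ (V⊆ , E⊆) → record { V⊆ = V⊆ ; E⊆ = E⊆ }) (λ F⊆G → Subgraph.V⊆ F⊆G , Subgraph.E⊆ F⊆G)
       (all? (λ x → implies? (V F x) (V G x)) ×-dec all? (λ x → all? (λ y → implies? (E F x y) (E G x y))))

counterexample : ∀ {a b} → ¬ (a ≡ true → b ≡ true) → a ≡ true × b ≡ false
counterexample {true}  {true}  a⇏b = ⊥-elim (a⇏b (λ _ → refl))
counterexample {true}  {false} _   = refl , refl
counterexample {false} {_}     a⇏b = ⊥-elim (a⇏b (λ ()))

⊆∧⊉⇒⊊ : ∀ {N} {G H : Gr N} → Subgraph G H → ¬ Subgraph H G → ProperSubgraph G H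
⊆∧⊉⇒⊊ {N} {G} {H} G⊆H H⊈G = G⊆H , missing
  where
    missing : _
    missing with all? (λ x → implies? (V H x) (V G x))
    ... | no V⊈ = inj₁ (map₂ counterexample (¬∀⟶∃¬ N _ (λ x → implies? (V H x) (V G x)) V⊈))
    ... | yes V⊆ with ¬∀⟶∃¬ N _ (λ x → all? (λ y → implies? (E H x y) (E G x y)))
                        (λ E⊆ → H⊈G (record { V⊆ = V⊆ ; E⊆ = E⊆ }))
    ...   | x , E⊈ with ¬∀⟶∃¬ N _ (λ y → implies? (E H x y) (E G x y)) E⊈
    ...     | y , exy = inj₂ (x , y , counterexample exy)

endpt-cases : ∀ {m} {x : Fin m} p → endpt x p ≡ true → x ≡ proj₁ p ⊎ x ≡ proj₂ p
endpt-cases {x = x} (u , w) h with ∨-cases ⌊ x ≟ u ⌋ h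
... | inj₁ x≟u = inj₁ (≟-sound x≟u)
... | inj₂ x≟w = inj₂ (≟-sound x≟w)

endpt-false : ∀ {m} {x : Fin m} p → x ≢ proj₁ p → x ≢ proj₂ p → endpt x p ≡ false
endpt-false _ x≢u x≢w rewrite ≟-≢ x≢u | ≟-≢ x≢w = refl

endpt-proj₁ : ∀ {m} (p : Fin m × Fin m) → endpt (proj₁ p) p ≡ true
endpt-proj₁ (u , w) rewrite ≟-refl u = refl

endpt-proj₂ : ∀ {m} (p : Fin m × Fin m) → endpt (proj₂ p) p ≡ true
endpt-proj₂ (u , w) = ∨-introʳ ⌊ w ≟ u ⌋ (≟-refl w)

samePair-cases : ∀ {m} {x y : Fin m} p → samePair x y p ≡ true →
                 (x ≡ proj₁ p × y ≡ proj₂ p) ⊎ (x ≡ proj₂ p × y ≡ proj₁ p)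
samePair-cases {x = x} {y} (u , w) h with ∨-cases (⌊ x ≟ u ⌋ ∧ ⌊ y ≟ w ⌋) h
... | inj₁ h₁ = inj₁ (≟-sound (∧-elimˡ ⌊ x ≟ u ⌋ h₁) , ≟-sound (∧-elimʳ ⌊ x ≟ u ⌋ h₁))
... | inj₂ h₂ = inj₂ (≟-sound (∧-elimˡ ⌊ x ≟ w ⌋ h₂) , ≟-sound (∧-elimʳ ⌊ x ≟ w ⌋ h₂))

samePair-sym : ∀ {m} (x y : Fin m) p → samePair x y p ≡ samePair y x p
samePair-sym x y (u , w) = trans (∨-comm (⌊ x ≟ u ⌋ ∧ ⌊ y ≟ w ⌋) (⌊ x ≟ w ⌋ ∧ ⌊ y ≟ u ⌋))
                                 (cong₂ _∨_ (∧-comm ⌊ x ≟ w ⌋ ⌊ y ≟ u ⌋) (∧-comm ⌊ x ≟ u ⌋ ⌊ y ≟ w ⌋))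

samePair⇒endpt : ∀ {m} {x y : Fin m} p → samePair x y p ≡ true → endpt x p ≡ true
samePair⇒endpt {x = x} {y} p h with samePair-cases {x = x} {y} p h
... | inj₁ (x≡u , _) = subst (λ z → endpt z p ≡ true) (sym x≡u) (endpt-proj₁ p)
... | inj₂ (x≡w , _) = subst (λ z → endpt z p ≡ true) (sym x≡w) (endpt-proj₂ p)

endpoint-sum : ∀ {m} (p : Fin m × Fin m) → proj₁ p ≢ proj₂ p → (P : Fin m → Bool) →
               ∑[ x < m ] ⟦ endpt x p ∧ P x ⟧ ≡ ⟦ P (proj₁ p) ⟧ + ⟦ P (proj₂ p) ⟧
endpoint-sum {m} (u , w) u≢w P = begin
    ∑[ x < m ] ⟦ (⌊ x ≟ u ⌋ ∨ ⌊ x ≟ w ⌋) ∧ P x ⟧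
  ≡⟨ sum-cong-≗ split ⟩
    ∑[ x < m ] (⟦ ⌊ x ≟ u ⌋ ⟧ * ⟦ P x ⟧ + ⟦ ⌊ x ≟ w ⌋ ⟧ * ⟦ P x ⟧)
  ≡⟨ ∑-distrib-+ (λ x → ⟦ ⌊ x ≟ u ⌋ ⟧ * ⟦ P x ⟧) (λ x → ⟦ ⌊ x ≟ w ⌋ ⟧ * ⟦ P x ⟧) ⟩
    ∑[ x < m ] (⟦ ⌊ x ≟ u ⌋ ⟧ * ⟦ P x ⟧) + ∑[ x < m ] (⟦ ⌊ x ≟ w ⌋ ⟧ * ⟦ P x ⟧)
  ≡⟨ cong₂ _+_ (∑-δˡ u (⟦_⟧ ∘ P)) (∑-δˡ w (⟦_⟧ ∘ P)) ⟩
    ⟦ P u ⟧ + ⟦ P w ⟧ ∎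
  where
    open ≡-Reasoning
    split : ∀ x → ⟦ (⌊ x ≟ u ⌋ ∨ ⌊ x ≟ w ⌋) ∧ P x ⟧ ≡ ⟦ ⌊ x ≟ u ⌋ ⟧ * ⟦ P x ⟧ + ⟦ ⌊ x ≟ w ⌋ ⟧ * ⟦ P x ⟧
    split x =
      trans (cong ⟦_⟧ (∧-distribʳ-∨ (P x) ⌊ x ≟ u ⌋ ⌊ x ≟ w ⌋))
      (trans (⟦∨⟧ (⌊ x ≟ u ⌋ ∧ P x) (⌊ x ≟ w ⌋ ∧ P x) (∧-disjoint ⌊ x ≟ u ⌋ ⌊ x ≟ w ⌋ (≟-disjoint x u≢w)))
             (cong₂ _+_ (⟦∧⟧ ⌊ x ≟ u ⌋ (P x)) (⟦∧⟧ ⌊ x ≟ w ⌋ (P x))))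

samePair-count : ∀ {m} (p : Fin m × Fin m) → proj₁ p ≢ proj₂ p → pairs (λ x y → samePair x y p) ≡ 2
samePair-count {m} (u , w) u≢w = begin
    pairs (λ x y → samePair x y (u , w))
  ≡⟨ sum-cong-≗ (λ x → sum-cong-≗ (split x)) ⟩
    ∑[ x < m ] ∑[ y < m ] (⟦ ⌊ x ≟ u ⌋ ⟧ * ⟦ ⌊ y ≟ w ⌋ ⟧ + ⟦ ⌊ x ≟ w ⌋ ⟧ * ⟦ ⌊ y ≟ u ⌋ ⟧)
  ≡⟨ sum-cong-≗ (λ x → trans (∑-distrib-+ (λ y → ⟦ ⌊ x ≟ u ⌋ ⟧ * ⟦ ⌊ y ≟ w ⌋ ⟧) (λ y → ⟦ ⌊ x ≟ w ⌋ ⟧ * ⟦ ⌊ y ≟ u ⌋ ⟧))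
                              (cong₂ _+_ (∑-*ˡ ⟦ ⌊ x ≟ u ⌋ ⟧ (λ y → ⟦ ⌊ y ≟ w ⌋ ⟧))
                                         (∑-*ˡ ⟦ ⌊ x ≟ w ⌋ ⟧ (λ y → ⟦ ⌊ y ≟ u ⌋ ⟧)))) ⟩
    ∑[ x < m ] (⟦ ⌊ x ≟ u ⌋ ⟧ * ∑[ y < m ] ⟦ ⌊ y ≟ w ⌋ ⟧ + ⟦ ⌊ x ≟ w ⌋ ⟧ * ∑[ y < m ] ⟦ ⌊ y ≟ u ⌋ ⟧)
  ≡⟨ sum-cong-≗ (λ x → cong₂ (λ s t → ⟦ ⌊ x ≟ u ⌋ ⟧ * s + ⟦ ⌊ x ≟ w ⌋ ⟧ * t) (∑-δ₁ w) (∑-δ₁ u)) ⟩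
    ∑[ x < m ] (⟦ ⌊ x ≟ u ⌋ ⟧ * 1 + ⟦ ⌊ x ≟ w ⌋ ⟧ * 1)
  ≡⟨ trans (∑-distrib-+ (λ x → ⟦ ⌊ x ≟ u ⌋ ⟧ * 1) (λ x → ⟦ ⌊ x ≟ w ⌋ ⟧ * 1))
           (cong₂ _+_ (∑-δˡ u (λ _ → 1)) (∑-δˡ w (λ _ → 1))) ⟩
    2 ∎
  where
    open ≡-Reasoning
    ∑-δ₁ : ∀ c → ∑[ y < m ] ⟦ ⌊ y ≟ c ⌋ ⟧ ≡ 1
    ∑-δ₁ c = trans (sum-cong-≗ (λ y → sym (*-identityʳ ⟦ ⌊ y ≟ c ⌋ ⟧))) (∑-δˡ c (λ _ → 1))
    split : ∀ x y → ⟦ samePair x y (u , w) ⟧ ≡ ⟦ ⌊ x ≟ u ⌋ ⟧ * ⟦ ⌊ y ≟ w ⌋ ⟧ + ⟦ ⌊ x ≟ w ⌋ ⟧ * ⟦ ⌊ y ≟ u ⌋ ⟧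
    split x y =
      trans (⟦∨⟧ (⌊ x ≟ u ⌋ ∧ ⌊ y ≟ w ⌋) (⌊ x ≟ w ⌋ ∧ ⌊ y ≟ u ⌋) (∧-disjoint ⌊ x ≟ u ⌋ ⌊ x ≟ w ⌋ (≟-disjoint x u≢w)))
            (cong₂ _+_ (⟦∧⟧ ⌊ x ≟ u ⌋ ⌊ y ≟ w ⌋) (⟦∧⟧ ⌊ x ≟ w ⌋ ⌊ y ≟ u ⌋))

pairs-∧ : ∀ {N} (R : Fin N → Fin N → Bool) β → pairs (λ x y → R x y ∧ β) ≡ pairs R * ⟦ β ⟧
pairs-∧ R true  = trans (sum-cong-≗ (λ x → sum-cong-≗ (λ y → cong ⟦_⟧ (∧-identityʳ (R x y)))))
                        (sym (*-identityʳ (pairs R)))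
pairs-∧ {N} R false = trans (sum-cong-≗ (λ x → trans (sum-cong-≗ (λ y → cong ⟦_⟧ (∧-zeroʳ (R x y))))
                                                      (sum-replicate-zero N)))
                            (trans (sum-replicate-zero N) (sym (*-comm (pairs R) 0)))

samePair-indicator : ∀ {m} (p : Fin m × Fin m) → proj₁ p ≢ proj₂ p → ∀ b →
                     pairs (λ x y → samePair x y p ∧ b) ≡ 2 * ⟦ b ⟧
samePair-indicator p u≢w b = trans (pairs-∧ (λ x y → samePair x y p) b) (cong (_* ⟦ b ⟧) (samePair-count p u≢w))

last-index : ∀ {D} (k : Fin (suc D)) → (toℕ k <ᵇ D) ≡ false → k ≡ fromℕ D
last-index {zero}  zero    _  = refl
last-index {suc D} (suc k) ≮D = cong suc (last-index k ≮D)

inject₁<ᵇ : ∀ {D} (j : Fin D) → (toℕ (inject₁ j) <ᵇ D) ≡ true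
inject₁<ᵇ {suc D} zero    = refl
inject₁<ᵇ {suc D} (suc j) = inject₁<ᵇ j

last-switch : ∀ {D} (f : Fin (suc D) → Bool) (k : Fin (suc D)) → f k ≡ false → f (fromℕ D) ≡ true →
              ∃[ j ] (f (inject₁ j) ≡ false × f (suc j) ≡ true)
last-switch {zero}  f zero    fk≡false fD≡true = ⊥-elim (not-¬ fD≡true fk≡false)
last-switch {suc D} f zero    f0≡false fD≡true with f (suc zero) in f1
... | true  = zero , f0≡false , f1
... | false = shift (last-switch (f ∘ suc) zero f1 fD≡true)
  where
    shift : ∃[ j ] (f (suc (inject₁ j)) ≡ false × f (suc (suc j)) ≡ true) →
            ∃[ j ] (f (inject₁ j) ≡ false × f (suc j) ≡ true)
    shift (j , switch) = suc j , switch
last-switch {suc D} f (suc k) fk≡false fD≡true with last-switch (f ∘ suc) k fk≡false fD≡true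
... | j , switch = suc j , switch

shifted-counts : ∀ {vH eH} → 4 ≤ vH → 2 * vH ≤ eH + 2 → ∃ λ A → ∃ λ B → vH ≡ A + 2 × eH ≡ B + 2 × A ≤ B
shifted-counts {suc (suc A)} {eH} (s≤s (s≤s _)) dense =
  A , eH ∸ 2 , +-comm 2 A , sym (m∸n+n≡m (m+n≤o⇒n≤o A A+2≤eH)) , m+n≤o⇒m≤o∸n A A+2≤eH
  where
    open ≤-Reasoning
    A+2≤eH : A + 2 ≤ eH
    A+2≤eH = +-cancelʳ-≤ 2 (A + 2) eH (begin
      A + 2 + 2           ≤⟨ m≤m+n (A + 2 + 2) A ⟩
      A + 2 + 2 + A       ≡⟨ solve (A ∷ []) ⟩
      2 * suc (suc A)     ≤⟨ dense ⟩
      eH + 2              ∎)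

empty-graph : ∀ {e v} → 2 * e + v ≤ v * v → v ≤ 1 → e ≡ 0
empty-graph {e} {zero}     edges z≤n       = m+n≡0⇒m≡0 e (m+n≡0⇒m≡0 (2 * e) (n≤0⇒n≡0 edges))
empty-graph {e} {suc zero} edges (s≤s z≤n) = m+n≡0⇒m≡0 e (n≤0⇒n≡0 (+-cancelʳ-≤ 1 (2 * e) 0 edges))

sparse-density : ∀ {A B e v} → 2 * e + v ≤ v * v → 2 ≤ v →
                 (3 ≤ v → e * A + 2 * B ≤ B * v + A) → e * A + 2 * B ≤ B * v + A
sparse-density {v = zero}     _ () _
sparse-density {v = suc zero} _ (s≤s ()) _
sparse-density {A} {B} {e} {suc (suc zero)} edges _ _ = begin
    e * A + 2 * B  ≤⟨ +-monoˡ-≤ (2 * B) (*-monoˡ-≤ A e≤1) ⟩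
    1 * A + 2 * B  ≡⟨ solve (A ∷ B ∷ []) ⟩
    B * 2 + A      ∎
  where
    open ≤-Reasoning
    e≤1 : e ≤ 1
    e≤1 = *-cancelˡ-≤ 2 (+-cancelʳ-≤ 2 (2 * e) 2 edges)
sparse-density {v = suc (suc (suc v))} _ _ dense = dense (s≤s (s≤s (s≤s z≤n)))

-- Cost of the s glued vertices of a copy: there are none in the first copy, and at most one
-- if the left gluing edge l is not in F; the cost B·s + 2B·[first] + A is at most 2B + A·[l].
gluing-cost : ∀ {A B s} first l → A ≤ B → 2 * ⟦ first ⟧ + s ≤ 2 → s ≤ 1 + ⟦ l ⟧ →
              (first ≡ true → l ≡ true) → B * s + 2 * B * ⟦ first ⟧ + A ≤ 2 * B + A * ⟦ l ⟧
gluing-cost {A} {B} true l _ (s≤s (s≤s z≤n)) _ first⇒l rewrite first⇒l refl =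
  ≤-reflexive (solve (A ∷ B ∷ []))
gluing-cost {A} {B} {s} false true _ s≤2 _ _ = begin
    B * s + 2 * B * 0 + A  ≡⟨ solve (A ∷ B ∷ s ∷ []) ⟩
    B * s + A              ≤⟨ +-monoˡ-≤ A (*-monoʳ-≤ B s≤2) ⟩
    B * 2 + A              ≡⟨ solve (A ∷ B ∷ []) ⟩
    2 * B + A * 1          ∎
  where open ≤-Reasoning
gluing-cost {A} {B} {s} false false A≤B _ s≤1 _ = begin
    B * s + 2 * B * 0 + A  ≡⟨ solve (A ∷ B ∷ s ∷ []) ⟩
    B * s + A              ≤⟨ +-mono-≤ (*-monoʳ-≤ B s≤1) A≤B ⟩
    B * 1 + B              ≡⟨ solve (A ∷ B ∷ []) ⟩
    2 * B + A * 0          ∎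
  where open ≤-Reasoning

-- Its trace has e edges and v vertices; N counts the ordered pairs
-- of edges of F inside the copy, s its glued vertices, φ = [it is the first copy], and λ′, ρ
-- whether its left and right gluing edges lie in F (then they are restored in the trace).
-- A copy whose trace is H pays for its edges, glued vertices and right edge with its vertices,
-- up to an excess of 2A.
full-copy-core : ∀ {A B e v N s ρ φ} →
  2 + 2 * ρ + N ≤ 2 * e → e ≤ B + 2 → A + 2 ≤ v → 2 * φ + s ≤ 2 →
  A * N + 2 * B * s + 4 * B * φ + 2 * A * ρ ≤ 2 * B * v + 2 * A
full-copy-core {A} {B} {e} {v} {N} {s} {ρ} {φ} edges e≤ v≥ glued =
  +-cancelʳ-≤ (2 * A) _ _ (begin
    A * N + 2 * B * s + 4 * B * φ + 2 * A * ρ + 2 * A     ≡⟨ solve (A ∷ B ∷ N ∷ s ∷ ρ ∷ φ ∷ []) ⟩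
    A * (2 + 2 * ρ + N) + 2 * B * (2 * φ + s)
      ≤⟨ +-mono-≤ (*-monoʳ-≤ A (≤-trans edges (*-monoʳ-≤ 2 e≤))) (*-monoʳ-≤ (2 * B) glued) ⟩
    A * (2 * (B + 2)) + 2 * B * 2                         ≡⟨ solve (A ∷ B ∷ []) ⟩
    2 * B * (A + 2) + 2 * A + 2 * A                       ≤⟨ +-monoˡ-≤ (2 * A) (+-monoˡ-≤ (2 * A) (*-monoʳ-≤ (2 * B) v≥)) ⟩
    2 * B * v + 2 * A + 2 * A                             ∎)
  where open ≤-Reasoning

-- The excess 2A of a full copy only occurs when its right edge is missing from F, which
-- only happens for the last copy.
full-copy-budget : ∀ {A B e v N s} first hasNext r →
  2 + 2 * ⟦ r ⟧ + N ≤ 2 * e → e ≤ B + 2 → A + 2 ≤ v → 2 * ⟦ first ⟧ + s ≤ 2 → (hasNext ≡ true → r ≡ true) →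
  A * N + 2 * B * s + 4 * B * ⟦ first ⟧ + 2 * A * 0 ≤ 2 * B * v + 2 * A * ⟦ not hasNext ⟧
full-copy-budget {A} {B} {e} {v} {N} {s} first hasNext r edges e≤ v≥ glued next⇒r =
  bonus hasNext r next⇒r (full-copy-core edges e≤ v≥ glued)
  where
    open ≤-Reasoning
    T = A * N + 2 * B * s + 4 * B * ⟦ first ⟧
    bonus : ∀ h r → (h ≡ true → r ≡ true) → T + 2 * A * ⟦ r ⟧ ≤ 2 * B * v + 2 * A →
            T + 2 * A * 0 ≤ 2 * B * v + 2 * A * ⟦ not h ⟧
    bonus h     true  _     budget = begin
      T + 2 * A * 0                ≡⟨ trans (cong (_+_ T) (*-zeroʳ (2 * A))) (+-identityʳ T) ⟩
      T                            ≤⟨ +-cancelʳ-≤ (2 * A) T (2 * B * v) budget′ ⟩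
      2 * B * v                    ≤⟨ m≤m+n (2 * B * v) _ ⟩
      2 * B * v + 2 * A * ⟦ not h ⟧ ∎
      where budget′ = subst (λ t → T + t ≤ 2 * B * v + 2 * A) (*-identityʳ (2 * A)) budget
    bonus false false _     budget = subst (λ t → T + 2 * A * 0 ≤ 2 * B * v + t) (sym (*-identityʳ (2 * A))) budget
    bonus true  false h⇒r _      with h⇒r refl
    ... | ()

-- A copy whose trace is a proper subgraph of H with at least two vertices: the density
-- inequality pays for its edges, its glued vertices and its right edge.
partial-copy-core : ∀ {A B e v N s λ′ ρ φ} →
  2 * λ′ + 2 * ρ + N ≤ 2 * e → e * A + 2 * B ≤ B * v + A → B * s + 2 * B * φ + A ≤ 2 * B + A * λ′ →
  A * N + 2 * B * s + 4 * B * φ + 2 * A * ρ ≤ 2 * B * v + 2 * A * 0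
partial-copy-core {A} {B} {e} {v} {N} {s} {λ′} {ρ} {φ} edges dense glued =
  +-cancelʳ-≤ (2 * A + 2 * A * λ′) _ _ (begin
    A * N + 2 * B * s + 4 * B * φ + 2 * A * ρ + (2 * A + 2 * A * λ′)
      ≡⟨ solve (A ∷ B ∷ N ∷ s ∷ φ ∷ λ′ ∷ ρ ∷ []) ⟩
    A * (2 * λ′ + 2 * ρ + N) + 2 * (B * s + 2 * B * φ + A)
      ≤⟨ +-mono-≤ (*-monoʳ-≤ A edges) (*-monoʳ-≤ 2 glued) ⟩
    A * (2 * e) + 2 * (2 * B + A * λ′)        ≡⟨ solve (A ∷ B ∷ e ∷ λ′ ∷ []) ⟩
    2 * (e * A + 2 * B) + 2 * A * λ′          ≤⟨ +-monoˡ-≤ (2 * A * λ′) (*-monoʳ-≤ 2 dense) ⟩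
    2 * (B * v + A) + 2 * A * λ′              ≡⟨ solve (A ∷ B ∷ v ∷ λ′ ∷ []) ⟩
    2 * B * v + 2 * A * 0 + (2 * A + 2 * A * λ′) ∎)
  where open ≤-Reasoning

empty-copy-budget : ∀ {A B v N s} first l r → 2 * ⟦ l ⟧ + 2 * ⟦ r ⟧ + N ≤ 2 * 0 → s ≤ v →
  (first ≡ true → l ≡ true) →
  A * N + 2 * B * s + 4 * B * ⟦ first ⟧ + 2 * A * ⟦ r ⟧ ≤ 2 * B * v + 2 * A * 0
empty-copy-budget _ true  _ () _ _
empty-copy-budget _ false true () _ _
empty-copy-budget true false false _ _ first⇒l with first⇒l refl
... | ()
empty-copy-budget {A} {B} {v} {N} {s} false false false no-edges s≤v _ = begin
    A * N + 2 * B * s + 4 * B * 0 + 2 * A * 0   ≡⟨ cong (λ t → A * t + 2 * B * s + 4 * B * 0 + 2 * A * 0) (n≤0⇒n≡0 no-edges) ⟩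
    A * 0 + 2 * B * s + 4 * B * 0 + 2 * A * 0   ≡⟨ solve (A ∷ B ∷ s ∷ []) ⟩
    2 * B * s                                   ≤⟨ *-monoʳ-≤ (2 * B) s≤v ⟩
    2 * B * v                                   ≡⟨ solve (A ∷ B ∷ v ∷ []) ⟩
    2 * B * v + 2 * A * 0                       ∎
  where open ≤-Reasoning

assemble : ∀ {A B eF vF N S V X L} →
  A * N + 2 * B * S + 4 * B + 2 * A * X ≤ 2 * B * V + 2 * A * L →
  2 * eF ≤ N → V ≤ vF + S → L ≤ X → eF * A + 2 * B ≤ B * vF
assemble {A} {B} {eF} {vF} {N} {S} {V} {X} {L} budget edges vertices bonus =
  *-cancelˡ-≤ 2 (+-cancelʳ-≤ (2 * B * S + 2 * A * X) _ _ (begin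
    2 * (eF * A + 2 * B) + (2 * B * S + 2 * A * X)  ≡⟨ solve (A ∷ B ∷ eF ∷ S ∷ X ∷ []) ⟩
    A * (2 * eF) + 2 * B * S + 4 * B + 2 * A * X
      ≤⟨ +-monoˡ-≤ (2 * A * X) (+-monoˡ-≤ (4 * B) (+-monoˡ-≤ (2 * B * S) (*-monoʳ-≤ A edges))) ⟩
    A * N + 2 * B * S + 4 * B + 2 * A * X           ≤⟨ budget ⟩
    2 * B * V + 2 * A * L                           ≤⟨ +-mono-≤ (*-monoʳ-≤ (2 * B) vertices) (*-monoʳ-≤ (2 * A) bonus) ⟩
    2 * B * (vF + S) + 2 * A * X                    ≡⟨ solve (A ∷ B ∷ vF ∷ S ∷ X ∷ []) ⟩
    2 * (B * vF) + (2 * B * S + 2 * A * X)          ∎))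
  where open ≤-Reasoning

module Copies {n : ℕ} (H : Gr n) (wfH : WF H) (es : ℕ → Fin n × Fin n)
  (es-edge : ∀ j → E H (proj₁ (es j)) (proj₂ (es j)) ≡ true)
  (es-disjoint : ∀ j → (proj₁ (es j) ≢ proj₁ (es (suc j))) × (proj₁ (es j) ≢ proj₂ (es (suc j)))
                     × (proj₂ (es j) ≢ proj₁ (es (suc j))) × (proj₂ (es j) ≢ proj₂ (es (suc j))))
  (d′ : ℕ) (F : Gr (suc d′ * n)) (wfF : WF F)
  (F⊆Hd : Subgraph F (Construction.Hd H es (suc d′))) where

  open Construction H es (suc d′)

  es-proper : ∀ j → proj₁ (es j) ≢ proj₂ (es j)
  es-proper j u≡w with trans (sym (es-edge j)) (trans (cong (E H (proj₁ (es j))) (sym u≡w)) (WF.irrefl wfH _))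
  ... | ()

  endpt-vertex : ∀ j {x} → endpt x (es j) ≡ true → V H x ≡ true
  endpt-vertex j {x} h with endpt-cases {x = x} (es j) h
  ... | inj₁ refl = WF.closedˡ wfH _ _ (es-edge j)
  ... | inj₂ refl = closedʳ wfH _ _ (es-edge j)

  consecutive-disjoint : ∀ j {x} → endpt x (es (suc j)) ≡ true → endpt x (es j) ≡ false
  consecutive-disjoint j {x} h with es-disjoint j | endpt-cases {x = x} (es (suc j)) h
  ... | d₁₁ , d₁₂ , d₂₁ , d₂₂ | inj₁ refl = endpt-false (es j) (d₁₁ ∘ sym) (d₂₁ ∘ sym)
  ... | d₁₁ , d₁₂ , d₂₁ , d₂₂ | inj₂ refl = endpt-false (es j) (d₁₂ ∘ sym) (d₂₂ ∘ sym)

  canon-own : ∀ k {x} → endpt x (es (toℕ k)) ≡ false → canon k x ≡ combine k x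
  canon-own zero    _ = refl
  canon-own (suc k) h rewrite h = refl

  canon-glued : ∀ (j : Fin d′) {x} → endpt x (es (suc (toℕ j))) ≡ true → canon (inject₁ j) x ≡ canon (suc j) x
  canon-glued j {x} h rewrite h =
    canon-own (inject₁ j) {x} (subst (λ i → endpt x (es i) ≡ false) (sym (toℕ-inject₁ j))
                                     (consecutive-disjoint (toℕ j) {x} h))

  inF : Fin (suc d′) → Fin n → Bool
  inF k x = V F (canon k x)

  bothIn : Fin (suc d′) → Fin n × Fin n → Bool
  bothIn k p = inF k (proj₁ p) ∧ inF k (proj₂ p)

  first hasNext : Fin (suc d′) → Bool
  first k   = toℕ k ≡ᵇ 0
  hasNext k = toℕ k <ᵇ d′

  left right : Fin (suc d′) → Bool
  left k  = bothIn k (es (toℕ k))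
  right k = hasNext k ∧ bothIn k (es (suc (toℕ k)))

  own restored : Fin (suc d′) → Fin n → Fin n → Bool
  own k x y      = E H x y ∧ not (removed k x y) ∧ E F (canon k x) (canon k y)
  restored k x y = E H x y ∧ removed k x y ∧ inF k x ∧ inF k y

  trace : Fin (suc d′) → Gr n
  trace k = mkGr (λ x → V H x ∧ inF k x) (λ x y → own k x y ∨ restored k x y)

  removed-sym : ∀ k x y → removed k x y ≡ removed k y x
  removed-sym k x y = cong₂ _∨_ (cong ((first k) ∧_) (samePair-sym x y (es 0)))
                        (cong₂ _∨_ (cong (not (first k) ∧_) (samePair-sym x y (es (toℕ k))))
                                   (cong (hasNext k ∧_) (samePair-sym x y (es (suc (toℕ k))))))

  own-sym : ∀ k x y → own k x y ≡ own k y x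
  own-sym k x y = cong₂ _∧_ (E-sym wfH x y) (cong₂ _∧_ (cong not (removed-sym k x y)) (E-sym wfF _ _))

  restored-sym : ∀ k x y → restored k x y ≡ restored k y x
  restored-sym k x y = cong₂ _∧_ (E-sym wfH x y) (cong₂ _∧_ (removed-sym k x y) (∧-comm (inF k x) (inF k y)))

  trace-WF : ∀ k → WF (trace k)
  trace-WF k = record
    { sym     = λ x y h → subst (_≡ true) (cong₂ _∨_ (own-sym k x y) (restored-sym k x y)) h
    ; irrefl  = loopless
    ; closedˡ = closed
    }
    where
      loopless : ∀ x → own k x x ∨ restored k x x ≡ false
      loopless x rewrite WF.irrefl wfH x = refl
      closed : ∀ x y → own k x y ∨ restored k x y ≡ true → V H x ∧ inF k x ≡ true
      closed x y h with ∨-cases (own k x y) h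
      ... | inj₁ o = ∧-intro (WF.closedˡ wfH x y (∧-elimˡ (E H x y) o))
                             (WF.closedˡ wfF _ _ (∧-elimʳ (not (removed k x y)) (∧-elimʳ (E H x y) o)))
      ... | inj₂ r = ∧-intro (WF.closedˡ wfH x y (∧-elimˡ (E H x y) r))
                             (∧-elimˡ (inF k x) (∧-elimʳ (removed k x y) (∧-elimʳ (E H x y) r)))

  trace-⊆ : ∀ k → Subgraph (trace k) H
  trace-⊆ k = record { V⊆ = λ x → ∧-elimˡ (V H x) ; E⊆ = edge }
    where
      edge : ∀ x y → own k x y ∨ restored k x y ≡ true → E H x y ≡ true
      edge x y h with ∨-cases (own k x y) h
      ... | inj₁ o = ∧-elimˡ (E H x y) o
      ... | inj₂ r = ∧-elimˡ (E H x y) r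

  trace-edges : ∀ k → 2 * e (trace k) ≡ pairs (own k) + pairs (restored k)
  trace-edges k = trans (handshake (trace k) (trace-WF k)) (pairs-∨ (own k) (restored k) disjoint)
    where
      disjoint : ∀ x y → own k x y ∧ restored k x y ≡ false
      disjoint x y = ∧-exclusive (own k x y) (restored k x y) λ o r →
        not-¬ (∧-elimˡ (removed k x y) (∧-elimʳ (E H x y) r))
              (not-true (∧-elimˡ (not (removed k x y)) (∧-elimʳ (E H x y) o)))

  removed-left : ∀ k {x y} → samePair x y (es (toℕ k)) ≡ true → removed k x y ≡ true
  removed-left zero    h rewrite h = refl
  removed-left (suc k) h rewrite h = refl

  removed-right : ∀ k {x y} → hasNext k ≡ true → samePair x y (es (suc (toℕ k))) ≡ true → removed k x y ≡ true
  removed-right k {x} {y} next same =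
    ∨-introʳ (first k ∧ samePair x y (es 0)) (∨-introʳ (not (first k) ∧ samePair x y (es (toℕ k))) (∧-intro next same))

  pair-restored : ∀ k p {x y} → samePair x y p ≡ true → E H (proj₁ p) (proj₂ p) ≡ true → bothIn k p ≡ true →
                  removed k x y ≡ true → restored k x y ≡ true
  pair-restored k (u , w) {x} {y} same edge both rem with samePair-cases {x = x} {y} (u , w) same
  ... | inj₁ (refl , refl) = ∧-intro edge (∧-intro rem both)
  ... | inj₂ (refl , refl) = ∧-intro (trans (E-sym wfH w u) edge) (∧-intro rem (trans (∧-comm (inF k w) (inF k u)) both))

  restored-bound : ∀ k → 2 * ⟦ left k ⟧ + 2 * ⟦ right k ⟧ ≤ pairs (restored k)
  restored-bound k = begin
      2 * ⟦ left k ⟧ + 2 * ⟦ right k ⟧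
    ≡⟨ sym (cong₂ _+_ (samePair-indicator L (es-proper (toℕ k)) (left k))
                      (samePair-indicator R (es-proper (suc (toℕ k))) (right k))) ⟩
      pairs (λ x y → samePair x y L ∧ left k) + pairs (λ x y → samePair x y R ∧ right k)
    ≡⟨ sym (pairs-∨ _ _ disjoint) ⟩
      pairs (λ x y → (samePair x y L ∧ left k) ∨ (samePair x y R ∧ right k))
    ≤⟨ pairs-mono restore ⟩
      pairs (restored k) ∎
    where
      open ≤-Reasoning
      L = es (toℕ k)
      R = es (suc (toℕ k))
      disjoint : ∀ x y → (samePair x y L ∧ left k) ∧ (samePair x y R ∧ right k) ≡ false
      disjoint x y = ∧-exclusive (samePair x y L ∧ left k) (samePair x y R ∧ right k) λ l r →
        not-¬ (samePair⇒endpt {x = x} {y} L (∧-elimˡ (samePair x y L) l))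
              (consecutive-disjoint (toℕ k) {x} (samePair⇒endpt {x = x} {y} R (∧-elimˡ (samePair x y R) r)))
      restore : ∀ x y → (samePair x y L ∧ left k) ∨ (samePair x y R ∧ right k) ≡ true → restored k x y ≡ true
      restore x y h with ∨-cases (samePair x y L ∧ left k) h
      ... | inj₁ l = pair-restored k L {x} {y} sameL (es-edge (toℕ k)) (∧-elimʳ (samePair x y L) l)
                                   (removed-left k {x} {y} sameL)
        where sameL = ∧-elimˡ (samePair x y L) l
      ... | inj₂ r = pair-restored k R {x} {y} sameR (es-edge (suc (toℕ k))) (∧-elimʳ (hasNext k) rightR)
                                   (removed-right k {x} {y} (∧-elimˡ (hasNext k) rightR) sameR)
        where sameR  = ∧-elimˡ (samePair x y R) r
              rightR = ∧-elimʳ (samePair x y R) r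

  edge-bound : ∀ k → 2 * ⟦ left k ⟧ + 2 * ⟦ right k ⟧ + pairs (own k) ≤ 2 * e (trace k)
  edge-bound k = begin
      2 * ⟦ left k ⟧ + 2 * ⟦ right k ⟧ + pairs (own k)  ≤⟨ +-monoˡ-≤ (pairs (own k)) (restored-bound k) ⟩
      pairs (restored k) + pairs (own k)              ≡⟨ +-comm (pairs (restored k)) (pairs (own k)) ⟩
      pairs (own k) + pairs (restored k)              ≡⟨ sym (trace-edges k) ⟩
      2 * e (trace k)                                 ∎
    where open ≤-Reasoning

  -- Vertices of copy k glued to the previous copy and lying in F: the endpoints of its left
  -- gluing edge, unless k is the first copy.
  glued : Fin (suc d′) → ℕ
  glued k = ∑[ x < n ] ⟦ endpt x (es (toℕ k)) ∧ (not (first k) ∧ inF k x) ⟧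

  glued-formula : ∀ k → glued k ≡ ⟦ not (first k) ∧ inF k (proj₁ (es (toℕ k))) ⟧
                                + ⟦ not (first k) ∧ inF k (proj₂ (es (toℕ k))) ⟧
  glued-formula k = endpoint-sum (es (toℕ k)) (es-proper (toℕ k)) (λ x → not (first k) ∧ inF k x)

  glued≤v : ∀ k → glued k ≤ v (trace k)
  glued≤v k = subst (glued k ≤_) (sym (v-∑ (trace k))) (∑-mono (λ x → ⟦⟧-mono (vertex x)))
    where
      vertex : ∀ x → endpt x (es (toℕ k)) ∧ (not (first k) ∧ inF k x) ≡ true → V H x ∧ inF k x ≡ true
      vertex x h = ∧-intro (endpt-vertex (toℕ k) (∧-elimˡ (endpt x (es (toℕ k))) h))
                           (∧-elimʳ (not (first k)) (∧-elimʳ (endpt x (es (toℕ k))) h))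

  glued-first : ∀ k → 2 * ⟦ first k ⟧ + glued k ≤ 2
  glued-first k = subst (λ g → 2 * ⟦ first k ⟧ + g ≤ 2) (sym (glued-formula k)) (count (first k) _ _)
    where
      count : ∀ f a b → 2 * ⟦ f ⟧ + (⟦ not f ∧ a ⟧ + ⟦ not f ∧ b ⟧) ≤ 2
      count true  _     _     = ≤-refl
      count false true  true  = ≤-refl
      count false true  false = s≤s z≤n
      count false false true  = s≤s z≤n
      count false false false = z≤n

  glued≤left : ∀ k → glued k ≤ 1 + ⟦ left k ⟧
  glued≤left k = subst (_≤ 1 + ⟦ left k ⟧) (sym (glued-formula k)) (count (not (first k)) _ _)
    where
      count : ∀ ν a b → ⟦ ν ∧ a ⟧ + ⟦ ν ∧ b ⟧ ≤ 1 + ⟦ a ∧ b ⟧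
      count true  true  true  = ≤-refl
      count true  true  false = ≤-refl
      count true  false true  = ≤-refl
      count true  false false = z≤n
      count false _     _     = z≤n

  -- Each vertex of F is counted by the traces once, plus once more for each copy in which it
  -- is a glued vertex.
  trace-vertex : ∀ k x → ⟦ V H x ∧ inF k x ⟧ ≤ ⟦ V F (combine k x) ⟧ + ⟦ endpt x (es (toℕ k)) ∧ (not (first k) ∧ inF k x) ⟧
  trace-vertex zero    x = ≤-trans (⟦⟧-mono (∧-elimʳ (V H x))) (m≤m+n _ _)
  trace-vertex (suc k) x with endpt x (es (suc (toℕ k)))
  ... | true  = ≤-trans (⟦⟧-mono (∧-elimʳ (V H x))) (m≤n+m _ _)
  ... | false = ≤-trans (⟦⟧-mono (∧-elimʳ (V H x))) (m≤m+n _ _)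

  vertex-count : ∑[ k < suc d′ ] v (trace k) ≤ v F + ∑[ k < suc d′ ] glued k
  vertex-count = begin
      ∑[ k < suc d′ ] v (trace k)
    ≡⟨ sum-cong-≗ (λ k → v-∑ (trace k)) ⟩
      ∑[ k < suc d′ ] ∑[ x < n ] ⟦ V H x ∧ inF k x ⟧
    ≤⟨ ∑-mono (λ k → ∑-mono (trace-vertex k)) ⟩
      ∑[ k < suc d′ ] ∑[ x < n ] (⟦ V F (combine k x) ⟧ + ⟦ endpt x (es (toℕ k)) ∧ (not (first k) ∧ inF k x) ⟧)
    ≡⟨ sum-cong-≗ (λ k → ∑-distrib-+ (λ x → ⟦ V F (combine k x) ⟧)
                                     (λ x → ⟦ endpt x (es (toℕ k)) ∧ (not (first k) ∧ inF k x) ⟧)) ⟩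
      ∑[ k < suc d′ ] (∑[ x < n ] ⟦ V F (combine k x) ⟧ + glued k)
    ≡⟨ ∑-distrib-+ (λ k → ∑[ x < n ] ⟦ V F (combine k x) ⟧) glued ⟩
      ∑[ k < suc d′ ] ∑[ x < n ] ⟦ V F (combine k x) ⟧ + ∑[ k < suc d′ ] glued k
    ≡⟨ cong (_+ ∑[ k < suc d′ ] glued k) (sym (trans (v-∑ F) (∑-combine {suc d′} {n} (⟦_⟧ ∘ V F)))) ⟩
      v F + ∑[ k < suc d′ ] glued k ∎
    where open ≤-Reasoning

  Hd-vertex-source : ∀ a → V Hd a ≡ true → ∃[ k ] ∃[ x ] (V H x ≡ true × canon k x ≡ a)
  Hd-vertex-source a h with any-witness _ (allFinL (suc d′)) h
  ... | k , hk with any-witness _ (allFinL n) hk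
  ... | x , hx = k , x , ∧-elimˡ (V H x) hx , ≟-sound (∧-elimʳ (V H x) hx)

  Hd-edge-source : ∀ a b → E Hd a b ≡ true →
                   ∃[ k ] ∃[ x ] ∃[ y ] (E H x y ≡ true × removed k x y ≡ false × canon k x ≡ a × canon k y ≡ b)
  Hd-edge-source a b h with any-witness _ (allFinL (suc d′)) h
  ... | k , hk with any-witness _ (allFinL n) hk
  ... | x , hx with any-witness _ (allFinL n) hx
  ... | y , hy = k , x , y , ∧-elimˡ (E H x y) hy , not-true (∧-elimˡ (not (removed k x y)) kept)
                 , ≟-sound (∧-elimˡ (eqV (canon k x) a) ends) , ≟-sound (∧-elimʳ (eqV (canon k x) a) ends)
    where
      kept = ∧-elimʳ (E H x y) hy
      ends = ∧-elimʳ (not (removed k x y)) kept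

  F-edge-source : ∀ {a b} → E F a b ≡ true → ∃[ k ] ∃[ x ] ∃[ y ] (own k x y ≡ true × canon k x ≡ a × canon k y ≡ b)
  F-edge-source {a} {b} h = lift (Hd-edge-source a b (Subgraph.E⊆ F⊆Hd a b h)) h
    where
      lift : ∀ {a b} → ∃[ k ] ∃[ x ] ∃[ y ] (E H x y ≡ true × removed k x y ≡ false × canon k x ≡ a × canon k y ≡ b) →
             E F a b ≡ true → ∃[ k ] ∃[ x ] ∃[ y ] (own k x y ≡ true × canon k x ≡ a × canon k y ≡ b)
      lift (k , x , y , edge , kept , refl , refl) h = k , x , y , ∧-intro edge (∧-intro (cong not kept) h) , refl , refl

  edge-count : 2 * e F ≤ ∑[ k < suc d′ ] pairs (own k)
  edge-count = begin
      2 * e F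
    ≡⟨ handshake F wfF ⟩
      pairs (E F)
    ≤⟨ ∑-mono (λ a → ∑-mono (λ b → source a b)) ⟩
      ∑[ a < N ] ∑[ b < N ] ∑[ k < suc d′ ] ∑[ x < n ] ∑[ y < n ] T a b k x y
    ≡⟨ ∑∑-outward (λ a b k → ∑[ x < n ] ∑[ y < n ] T a b k x y) ⟩
      ∑[ k < suc d′ ] ∑[ a < N ] ∑[ b < N ] ∑[ x < n ] ∑[ y < n ] T a b k x y
    ≡⟨ sum-cong-≗ (λ k → ∑∑-outward (λ a b x → ∑[ y < n ] T a b k x y)) ⟩
      ∑[ k < suc d′ ] ∑[ x < n ] ∑[ a < N ] ∑[ b < N ] ∑[ y < n ] T a b k x y
    ≡⟨ sum-cong-≗ (λ k → sum-cong-≗ (λ x → ∑∑-outward (λ a b y → T a b k x y))) ⟩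
      ∑[ k < suc d′ ] ∑[ x < n ] ∑[ y < n ] ∑[ a < N ] ∑[ b < N ] T a b k x y
    ≡⟨ sum-cong-≗ (λ k → sum-cong-≗ (λ x → sum-cong-≗ (λ y → ∑∑-δ (canon k x) (canon k y) ⟦ own k x y ⟧))) ⟩
      ∑[ k < suc d′ ] pairs (own k) ∎
    where
      open ≤-Reasoning
      N = suc d′ * n
      T : Fin N → Fin N → Fin (suc d′) → Fin n → Fin n → ℕ
      T a b k x y = ⟦ ⌊ canon k x ≟ a ⌋ ⟧ * (⟦ ⌊ canon k y ≟ b ⌋ ⟧ * ⟦ own k x y ⟧)
      witnessed : ∀ {a b} → ∃[ k ] ∃[ x ] ∃[ y ] (own k x y ≡ true × canon k x ≡ a × canon k y ≡ b) →
                  1 ≤ ∑[ k < suc d′ ] ∑[ x < n ] ∑[ y < n ] T a b k x y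
      witnessed {a} {b} (k , x , y , o , refl , refl) =
        ≤-trans (≤-reflexive (sym one))
          (≤-trans (term≤∑ (T a b k x) y)
            (≤-trans (term≤∑ (λ x → ∑[ y < n ] T a b k x y) x)
                     (term≤∑ (λ k → ∑[ x < n ] ∑[ y < n ] T a b k x y) k)))
        where
          one : T a b k x y ≡ 1
          one rewrite ≟-refl (canon k x) | ≟-refl (canon k y) | o = refl
      source : ∀ a b → ⟦ E F a b ⟧ ≤ ∑[ k < suc d′ ] ∑[ x < n ] ∑[ y < n ] T a b k x y
      source a b = ⟦⟧-bound (witnessed ∘ F-edge-source)

  -- Copy k is full when its trace is all of H; otherwise its trace is a proper subgraph of H.
  -- (Opaque, so that case analysis on full k is not blocked by the unfolding of the decision procedure.)
  opaque
    full : Fin (suc d′) → Bool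
    full k = does (subgraph? H (trace k))

    full⇒⊇ : ∀ k → full k ≡ true → Subgraph H (trace k)
    full⇒⊇ k = does-true (subgraph? H (trace k))

    partial⇒⊊ : ∀ k → full k ≡ false → ProperSubgraph (trace k) H
    partial⇒⊊ k is-partial = ⊆∧⊉⇒⊊ (trace-⊆ k) (does-false (subgraph? H (trace k)) is-partial)

  full⇒inF : ∀ k → full k ≡ true → ∀ {x} → V H x ≡ true → inF k x ≡ true
  full⇒inF k is-full {x} x∈H = ∧-elimʳ (V H x) (Subgraph.V⊆ (full⇒⊇ k is-full) x x∈H)

  full⇒bothIn : ∀ k → full k ≡ true → ∀ j → bothIn k (es j) ≡ true
  full⇒bothIn k is-full j = ∧-intro (full⇒inF k is-full (WF.closedˡ wfH _ _ (es-edge j)))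
                                    (full⇒inF k is-full (closedʳ wfH _ _ (es-edge j)))

  full⇒right : ∀ k → full k ≡ true → hasNext k ≡ true → right k ≡ true
  full⇒right k is-full next = ∧-intro next (full⇒bothIn k is-full (suc (toℕ k)))

  -- The right gluing edge of copy j is in F when copy j+1 is full, since it is glued to the
  -- left gluing edge of copy j+1.
  next-full⇒right : ∀ (j : Fin d′) → full (suc j) ≡ true → right (inject₁ j) ≡ true
  next-full⇒right j is-full =
    ∧-intro (inject₁<ᵇ j) (subst (λ i → bothIn (inject₁ j) (es (suc i)) ≡ true) (sym (toℕ-inject₁ j))
                                 (trans shared (full⇒bothIn (suc j) is-full (suc (toℕ j)))))
    where
      p = es (suc (toℕ j))
      same : ∀ {x} → endpt x p ≡ true → inF (inject₁ j) x ≡ inF (suc j) x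
      same h = cong (V F) (canon-glued j h)
      shared : bothIn (inject₁ j) p ≡ bothIn (suc j) p
      shared = cong₂ _∧_ (same (endpt-proj₁ p)) (same (endpt-proj₂ p))

  some-partial : ProperSubgraph F Hd → ∃[ k ] full k ≡ false
  some-partial (_ , inj₁ (a , a∈Hd , a∉F)) = from-vertex (Hd-vertex-source a a∈Hd) a∉F
    where
      from-vertex : ∀ {a} → ∃[ k ] ∃[ x ] (V H x ≡ true × canon k x ≡ a) → V F a ≡ false → ∃[ k ] full k ≡ false
      from-vertex (k , x , x∈H , refl) a∉F with full k in is-full
      ... | false = k , is-full
      ... | true  = ⊥-elim (not-¬ (full⇒inF k is-full x∈H) a∉F)
  some-partial (_ , inj₂ (a , b , ab∈Hd , ab∉F)) = from-edge (Hd-edge-source a b ab∈Hd) ab∉F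
    where
      from-edge : ∀ {a b} → ∃[ k ] ∃[ x ] ∃[ y ] (E H x y ≡ true × removed k x y ≡ false × canon k x ≡ a × canon k y ≡ b) →
                  E F a b ≡ false → ∃[ k ] full k ≡ false
      from-edge (k , x , y , xy∈H , kept , refl , refl) ab∉F with full k in is-full
      ... | false = k , is-full
      ... | true with ∨-cases (own k x y) (Subgraph.E⊆ (full⇒⊇ k is-full) x y xy∈H)
      ...   | inj₁ o = ⊥-elim (not-¬ (∧-elimʳ (not (removed k x y)) (∧-elimʳ (E H x y) o)) ab∉F)
      ...   | inj₂ r = ⊥-elim (not-¬ (∧-elimˡ (removed k x y) (∧-elimʳ (E H x y) r)) kept)

  -- Chain argument: if the last copy is full while some copy is not, then the last switch
  -- from a non-full copy j to a full copy j+1 has its right gluing edge in F.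
  bonus-bound : ProperSubgraph F Hd →
                ∑[ k < suc d′ ] ⟦ full k ∧ not (hasNext k) ⟧ ≤ ∑[ k < suc d′ ] ⟦ not (full k) ∧ right k ⟧
  bonus-bound proper = ≤-trans (≤-trans (∑-mono only-last) (≤-reflexive (∑-δˡ (fromℕ d′) (⟦_⟧ ∘ full)))) switch
    where
      only-last : ∀ k → ⟦ full k ∧ not (hasNext k) ⟧ ≤ ⟦ ⌊ k ≟ fromℕ d′ ⌋ ⟧ * ⟦ full k ⟧
      only-last k with full k | hasNext k in next
      ... | false | _     = z≤n
      ... | true  | true  = z≤n
      ... | true  | false rewrite last-index k next | ≟-refl (fromℕ d′) = ≤-refl
      switch : ⟦ full (fromℕ d′) ⟧ ≤ ∑[ k < suc d′ ] ⟦ not (full k) ∧ right k ⟧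
      switch with full (fromℕ d′) in last-full
      ... | false = z≤n
      ... | true with some-partial proper
      ...   | k , k-partial with last-switch full k k-partial last-full
      ...     | j , j-partial , j+1-full =
                subst (_≤ ∑[ k < suc d′ ] ⟦ not (full k) ∧ right k ⟧) one
                      (term≤∑ (λ k → ⟦ not (full k) ∧ right k ⟧) (inject₁ j))
        where
          one : ⟦ not (full (inject₁ j)) ∧ right (inject₁ j) ⟧ ≡ 1
          one rewrite j-partial | next-full⇒right j j+1-full = refl

  module Budget (A B : ℕ) (A≤B : A ≤ B) (vH≡ : v H ≡ A + 2) (eH≡ : e H ≡ B + 2)
    (balanced : ∀ G → WF G → ProperSubgraph G H → 3 ≤ v G → e G * A + 2 * B ≤ B * v G + A)
    (root : left zero ≡ true) where

    first⇒left : ∀ k → first k ≡ true → left k ≡ true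
    first⇒left zero    _  = root
    first⇒left (suc k) ()

    partial-density : ∀ k → full k ≡ false → 2 ≤ v (trace k) →
                      e (trace k) * A + 2 * B ≤ B * v (trace k) + A
    partial-density k is-partial 2≤v =
      sparse-density {A} {B} {e (trace k)} {v (trace k)} (edges≤ (trace k) (trace-WF k)) 2≤v
                     (balanced (trace k) (trace-WF k) (partial⇒⊊ k is-partial))

    copy-budget : ∀ k →
      A * pairs (own k) + 2 * B * glued k + 4 * B * ⟦ first k ⟧ + 2 * A * ⟦ not (full k) ∧ right k ⟧
        ≤ 2 * B * v (trace k) + 2 * A * ⟦ full k ∧ not (hasNext k) ⟧
    copy-budget k with full k in is-full
    ... | true = full-copy-budget {A} {B} {e (trace k)} {v (trace k)} {pairs (own k)} {glued k}
                   (first k) (hasNext k) (right k)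
                   (subst (λ l → 2 * ⟦ l ⟧ + 2 * ⟦ right k ⟧ + pairs (own k) ≤ 2 * e (trace k))
                          (full⇒bothIn k is-full (toℕ k)) (edge-bound k))
                   (subst (e (trace k) ≤_) eH≡ (e-mono (trace-⊆ k)))
                   (subst (_≤ v (trace k)) vH≡ (v-mono (full⇒⊇ k is-full)))
                   (glued-first k) (full⇒right k is-full)
    ... | false with v (trace k) ≤? 1
    ...   | yes v≤1 = empty-copy-budget {A} {B} {v (trace k)} {pairs (own k)} {glued k}
                        (first k) (left k) (right k)
                        (subst (λ e′ → 2 * ⟦ left k ⟧ + 2 * ⟦ right k ⟧ + pairs (own k) ≤ 2 * e′)
                               (empty-graph {e (trace k)} {v (trace k)} (edges≤ (trace k) (trace-WF k)) v≤1) (edge-bound k))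
                        (glued≤v k) (first⇒left k)
    ...   | no  v≰1 = partial-copy-core {A} {B} {e (trace k)} {v (trace k)} {pairs (own k)} {glued k}
                        (edge-bound k) (partial-density k is-full (≰⇒> v≰1))
                        (gluing-cost {A} {B} {glued k} (first k) (left k) A≤B (glued-first k) (glued≤left k)
                                     (first⇒left k))

    total-budget :
      A * ∑[ k < suc d′ ] pairs (own k) + 2 * B * ∑[ k < suc d′ ] glued k + 4 * B
        + 2 * A * ∑[ k < suc d′ ] ⟦ not (full k) ∧ right k ⟧
      ≤ 2 * B * ∑[ k < suc d′ ] v (trace k) + 2 * A * ∑[ k < suc d′ ] ⟦ full k ∧ not (hasNext k) ⟧
    total-budget = begin
        A * ∑[ k < suc d′ ] pairs (own k) + 2 * B * ∑[ k < suc d′ ] glued k + 4 * B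
          + 2 * A * ∑[ k < suc d′ ] ⟦ not (full k) ∧ right k ⟧
      ≡⟨ cong (λ t → A * ∑[ k < suc d′ ] pairs (own k) + 2 * B * ∑[ k < suc d′ ] glued k + t
                       + 2 * A * ∑[ k < suc d′ ] ⟦ not (full k) ∧ right k ⟧)
              (trans (sym (*-identityʳ (4 * B))) (cong (4 * B *_) (sym one-first))) ⟩
        A * ∑[ k < suc d′ ] pairs (own k) + 2 * B * ∑[ k < suc d′ ] glued k + 4 * B * ∑[ k < suc d′ ] ⟦ first k ⟧
          + 2 * A * ∑[ k < suc d′ ] ⟦ not (full k) ∧ right k ⟧
      ≡⟨ sym (∑-linear A (2 * B) (4 * B) (2 * A) (pairs ∘ own) glued (⟦_⟧ ∘ first) (λ k → ⟦ not (full k) ∧ right k ⟧)) ⟩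
        ∑[ k < suc d′ ] (A * pairs (own k) + 2 * B * glued k + 4 * B * ⟦ first k ⟧ + 2 * A * ⟦ not (full k) ∧ right k ⟧)
      ≤⟨ ∑-mono copy-budget ⟩
        ∑[ k < suc d′ ] (2 * B * v (trace k) + 2 * A * ⟦ full k ∧ not (hasNext k) ⟧)
      ≡⟨ ∑-linear₂ (2 * B) (2 * A) (v ∘ trace) (λ k → ⟦ full k ∧ not (hasNext k) ⟧) ⟩
        2 * B * ∑[ k < suc d′ ] v (trace k) + 2 * A * ∑[ k < suc d′ ] ⟦ full k ∧ not (hasNext k) ⟧ ∎
      where
        open ≤-Reasoning
        one-first : ∑[ k < suc d′ ] ⟦ first k ⟧ ≡ 1
        one-first = cong suc (∑-zero {d′} {λ k → ⟦ first (suc k) ⟧} (λ _ → refl))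

    density : ProperSubgraph F Hd → e F * A + 2 * B ≤ B * v F
    density proper = assemble {A} {B} {e F} {v F} total-budget edge-count vertex-count (bonus-bound proper)

ℤ⇒ℕ-≤ : ∀ {X Y : ℤ} c {p q} → X ℤ.+ + c ≡ + p → Y ℤ.+ + c ≡ + q → X ℤ.≤ Y → p ≤ q
ℤ⇒ℕ-≤ c X+c Y+c X≤Y = ℤ.drop‿+≤+ (subst₂ ℤ._≤_ X+c Y+c (ℤ.+-monoˡ-≤ (+ c) X≤Y))

ℕ⇒ℤ-≤ : ∀ {X Y : ℤ} c {p q} → X ℤ.+ + c ≡ + p → Y ℤ.+ + c ≡ + q → p ≤ q → X ℤ.≤ Y
ℕ⇒ℤ-≤ {X} {Y} c X+c Y+c p≤q =
  subst₂ ℤ._≤_ (unshift X X+c) (unshift Y Y+c) (ℤ.+-monoˡ-≤ (ℤ.- + c) (+≤+ p≤q))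
  where
    cancel : ∀ (z c : ℤ) → z ℤ.+ c ℤ.- c ≡ z
    cancel = ℤ-Solver.solve-∀
    unshift : ∀ Z {p} → Z ℤ.+ + c ≡ + p → + p ℤ.- + c ≡ Z
    unshift Z Z+c = trans (cong (ℤ._- + c) (sym Z+c)) (cancel Z (+ c))

balanced-ℕ : ∀ {A B vH eH e′ v′} → vH ≡ A + 2 → eH ≡ B + 2 →
  ((+ e′) ℤ.- + 1) ℤ.* ((+ vH) ℤ.- + 2) ℤ.≤ ((+ eH) ℤ.- + 2) ℤ.* ((+ v′) ℤ.- + 2) →
  e′ * A + 2 * B ≤ B * v′ + A
balanced-ℕ {A} {B} {e′ = e′} {v′} refl refl = ℤ⇒ℕ-≤ (A + 2 * B) lhs rhs
  where
    shift : + (A + 2 * B) ≡ + A ℤ.+ + 2 ℤ.* + B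
    shift = trans (ℤ.pos-+ A (2 * B)) (cong (ℤ._+_ (+ A)) (ℤ.pos-* 2 B))
    lhs-ring : ∀ (e a b : ℤ) → (e ℤ.- + 1) ℤ.* ((a ℤ.+ + 2) ℤ.- + 2) ℤ.+ (a ℤ.+ + 2 ℤ.* b) ≡ e ℤ.* a ℤ.+ + 2 ℤ.* b
    lhs-ring = ℤ-Solver.solve-∀
    rhs-ring : ∀ (v a b : ℤ) → ((b ℤ.+ + 2) ℤ.- + 2) ℤ.* (v ℤ.- + 2) ℤ.+ (a ℤ.+ + 2 ℤ.* b) ≡ b ℤ.* v ℤ.+ a
    rhs-ring = ℤ-Solver.solve-∀
    lhs : ((+ e′) ℤ.- + 1) ℤ.* ((+ (A + 2)) ℤ.- + 2) ℤ.+ + (A + 2 * B) ≡ + (e′ * A + 2 * B)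
    lhs = trans (cong₂ (λ a c → ((+ e′) ℤ.- + 1) ℤ.* (a ℤ.- + 2) ℤ.+ c) (ℤ.pos-+ A 2) shift)
         (trans (lhs-ring (+ e′) (+ A) (+ B))
                (sym (trans (ℤ.pos-+ (e′ * A) (2 * B)) (cong₂ ℤ._+_ (ℤ.pos-* e′ A) (ℤ.pos-* 2 B)))))
    rhs : ((+ (B + 2)) ℤ.- + 2) ℤ.* ((+ v′) ℤ.- + 2) ℤ.+ + (A + 2 * B) ≡ + (B * v′ + A)
    rhs = trans (cong₂ (λ b c → (b ℤ.- + 2) ℤ.* ((+ v′) ℤ.- + 2) ℤ.+ c) (ℤ.pos-+ B 2) shift)
         (trans (rhs-ring (+ v′) (+ A) (+ B))
                (sym (trans (ℤ.pos-+ (B * v′) A) (cong (ℤ._+ + A) (ℤ.pos-* B v′)))))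

density-ℤ : ∀ {A B vH eH eF vF} → vH ≡ A + 2 → eH ≡ B + 2 → eF * A + 2 * B ≤ B * vF →
  (+ eF) ℤ.* ((+ vH) ℤ.- + 2) ℤ.≤ ((+ vF) ℤ.- + 2) ℤ.* ((+ eH) ℤ.- + 2)
density-ℤ {A} {B} {eF = eF} {vF} refl refl = ℕ⇒ℤ-≤ (2 * B) lhs rhs
  where
    lhs-ring : ∀ (e a b : ℤ) → e ℤ.* ((a ℤ.+ + 2) ℤ.- + 2) ℤ.+ + 2 ℤ.* b ≡ e ℤ.* a ℤ.+ + 2 ℤ.* b
    lhs-ring = ℤ-Solver.solve-∀
    rhs-ring : ∀ (v b : ℤ) → (v ℤ.- + 2) ℤ.* ((b ℤ.+ + 2) ℤ.- + 2) ℤ.+ + 2 ℤ.* b ≡ b ℤ.* v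
    rhs-ring = ℤ-Solver.solve-∀
    lhs : (+ eF) ℤ.* ((+ (A + 2)) ℤ.- + 2) ℤ.+ + (2 * B) ≡ + (eF * A + 2 * B)
    lhs = trans (cong₂ (λ a c → (+ eF) ℤ.* (a ℤ.- + 2) ℤ.+ c) (ℤ.pos-+ A 2) (ℤ.pos-* 2 B))
         (trans (lhs-ring (+ eF) (+ A) (+ B))
                (sym (trans (ℤ.pos-+ (eF * A) (2 * B)) (cong₂ ℤ._+_ (ℤ.pos-* eF A) (ℤ.pos-* 2 B)))))
    rhs : ((+ vF) ℤ.- + 2) ℤ.* ((+ (B + 2)) ℤ.- + 2) ℤ.+ + (2 * B) ≡ + (B * vF)
    rhs = trans (cong₂ (λ b c → ((+ vF) ℤ.- + 2) ℤ.* (b ℤ.- + 2) ℤ.+ c) (ℤ.pos-+ B 2) (ℤ.pos-* 2 B))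
         (trans (rhs-ring (+ vF) (+ B)) (sym (ℤ.pos-* B vF)))

lemma7 : ∀ {n : ℕ} (H : Gr n) → WF H → Balanced H → 4 ≤ v H →
         (es : ℕ → Fin n × Fin n) →
         (∀ j → E H (proj₁ (es j)) (proj₂ (es j)) ≡ true) →
         (∀ j → (proj₁ (es j) ≢ proj₁ (es (suc j))) × (proj₁ (es j) ≢ proj₂ (es (suc j)))
              × (proj₂ (es j) ≢ proj₁ (es (suc j))) × (proj₂ (es j) ≢ proj₂ (es (suc j)))) →
         (d : ℕ) (d>0 : 0 < d) →
         let open Construction H es d in
         (F : Gr (d * n)) → WF F → ProperSubgraph F Hd →
         V F (root₁ d>0) ≡ true → V F (root₂ d>0) ≡ true →
         (+ e F) ℤ.* ((+ v H) ℤ.- + 2) ℤ.≤ ((+ v F) ℤ.- + 2) ℤ.* ((+ e H) ℤ.- + 2)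
lemma7 H wfH (dense , balanced) 4≤vH es es-edge es-disjoint (suc d′) (s≤s z≤n) F wfF F⊊Hd root₁∈F root₂∈F
  with shifted-counts 4≤vH dense
... | A , B , vH≡ , eH≡ , A≤B = density-ℤ {eF = e F} {v F} vH≡ eH≡ (density F⊊Hd)
  where
    open Copies H wfH es es-edge es-disjoint d′ F wfF (proj₁ F⊊Hd)
    open Budget A B A≤B vH≡ eH≡
                (λ G wfG G⊊H 3≤vG → balanced-ℕ {e′ = e G} {v G} vH≡ eH≡ (balanced G wfG G⊊H 3≤vG))
                (∧-intro root₁∈F root₂∈F)
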